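{- Let $t\ge 2$ be an integer. Every $t$-CNF theory (respectively, every normal $t$-program, every disjunctive $t$-program) with $n$ atoms has at most $\alpha_t^n\le (2-1/2^t)^n$ minimal models (respectively, stable models, answer sets), where $\alpha_t$ is the unique positive root of $1+\tau+\tau^2+\cdots+\tau^{t-1}=\tau^t$.
   Context: A $t$-CNF theory is a finite set of propositional clauses, each containing at most $t$ literals (no repeated literal, no complementary pair). A normal program clause has the form $a \leftarrow b_1,\ldots,b_r,\mathbf{not}(c_1),\ldots,\mathbf{not}(c_s)$ and a disjunctive one the form $a_1\vee\cdots\vee a_p \leftarrow b_1,\ldots,b_r,\mathbf{not}(c_1),\ldots,\mathbf{not}(c_s)$; a (normal or disjunctive) $t$-program is a finite set of such clauses, each with at most $t$ literals. Models, stable models (Gelfond–Lifschitz) and answer sets (minimal models of the Gelfond–Lifschitz reduct $P^M$) are represented as sets of true atoms; a model is minimal if no proper subset is a model. $n$ is the number of atoms. -}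

module Defs where

open import Data.Nat using (ℕ; zero; suc; _≤_) renaming (_+_ to _+ℕ_; _^_ to _^ℕ_; _∸_ to _∸_)
open import Data.Nat.Properties using (m^n≢0)
open import Data.Bool using (Bool; true; false; not)
open import Data.Fin using (Fin)
open import Data.Fin.Subset using (Subset; _∈_; _∉_; _⊆_; _⊂_)
open import Data.List using (List; []; _∷_; length; map; filter)
open import Data.List.Relation.Unary.All using (All)
open import Data.List.Relation.Unary.Any using (Any; any?)
open import Data.Fin.Subset.Properties using (_∈?_)
open import Relation.Nullary using (¬?)
open import Data.List.Relation.Unary.Unique.Propositional using (Unique)
open import Data.List.Membership.Propositional using () renaming (_∈_ to _∈L_)
open import Data.Product using (Σ; _×_)
open import Data.Integer using (+_)
open import Data.Rational using (ℚ; 0ℚ; 1ℚ; _+_; _*_; _/_; _<_) renaming (_≤_ to _≤ℚ_)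
open import Relation.Nullary using (¬_)
open import Relation.Binary.PropositionalEquality using (_≡_)

_^ℚ_ : ℚ → ℕ → ℚ
q ^ℚ zero  = 1ℚ
q ^ℚ suc k = q * (q ^ℚ k)

geomSum : ℚ → ℕ → ℚ
geomSum q zero    = 0ℚ
geomSum q (suc k) = geomSum q k + (q ^ℚ k)

ℕ→ℚ : ℕ → ℚ
ℕ→ℚ k = (+ k) / 1

-- For t ≥ 2 the polynomial τ^t - (1 + τ + ... + τ^(t-1)) has a unique
-- positive root α_t; it is negative on (0, α_t) and positive on (α_t, ∞).
-- Hence the positive rationals q with 1 + ... + q^(t-1) ≤ q^t are exactly
-- the rationals q ≥ α_t (the upper Dedekind cut of α_t).
AboveAlpha : ℕ → ℚ → Set
AboveAlpha t q = (0ℚ < q) × (geomSum q t ≤ℚ (q ^ℚ t))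

-- N ≤ α_t ^ n  (as a real inequality), i.e. N ≤ q^n for every rational q ≥ α_t
_≤α[_]^_ : ℕ → ℕ → ℕ → Set
N ≤α[ t ]^ n = ∀ (q : ℚ) → AboveAlpha t q → ℕ→ℚ N ≤ℚ (q ^ℚ n)

record Literal (n : ℕ) : Set where
  constructor lit
  field
    atom     : Fin n
    positive : Bool

open Literal public

complement : ∀ {n} → Literal n → Literal n
complement (lit a b) = lit a (not b)

Clause : ℕ → Set
Clause n = List (Literal n)

IsTClause : ∀ {n} → ℕ → Clause n → Set
IsTClause t C = (length C ≤ t) × Unique C × All (λ l → ¬ (complement l ∈L C)) C

CNF : ℕ → Set
CNF n = List (Clause n)

IsTCNF : ∀ {n} → ℕ → CNF n → Set
IsTCNF t T = All (IsTClause t) T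

SatLit : ∀ {n} → Subset n → Literal n → Set
SatLit M (lit a true)  = a ∈ M
SatLit M (lit a false) = a ∉ M

IsModelCNF : ∀ {n} → CNF n → Subset n → Set
IsModelCNF T M = All (Any (SatLit M)) T

IsMinimalModelCNF : ∀ {n} → CNF n → Subset n → Set
IsMinimalModelCNF T M =
  IsModelCNF T M × ¬ (Σ (Subset _) λ M' → IsModelCNF T M' × (M' ⊂ M))

record DClause (n : ℕ) : Set where
  constructor _⇐_,not_
  field
    heads : List (Fin n)
    pos   : List (Fin n)
    neg   : List (Fin n)

open DClause public

size : ∀ {n} → DClause n → ℕ
size C = length (heads C) +ℕ length (pos C) +ℕ length (neg C)

Program : ℕ → Set
Program n = List (DClause n)

IsNormalClause : ∀ {n} → DClause n → Set
IsNormalClause C = length (heads C) ≡ 1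

IsDisjClause : ∀ {n} → DClause n → Set
IsDisjClause C = 1 ≤ length (heads C)

IsNormalTProgram : ∀ {n} → ℕ → Program n → Set
IsNormalTProgram t P = All (λ C → IsNormalClause C × (size C ≤ t)) P

IsDisjTProgram : ∀ {n} → ℕ → Program n → Set
IsDisjTProgram t P = All (λ C → IsDisjClause C × (size C ≤ t)) P

SatClause : ∀ {n} → Subset n → DClause n → Set
SatClause M C =
  All (_∈ M) (pos C) → All (_∉ M) (neg C) → Any (_∈ M) (heads C)

IsModelP : ∀ {n} → Program n → Subset n → Set
IsModelP P M = All (SatClause M) P

reduct : ∀ {n} → Program n → Subset n → Program n
reduct P M =
  map (λ C → heads C ⇐ pos C ,not [])
      (filter (λ C → ¬? (any? (λ x → x ∈? M) (neg C))) P)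

IsStableModel : ∀ {n} → Program n → Subset n → Set
IsStableModel P M =
  IsModelP (reduct P M) M × (∀ M' → IsModelP (reduct P M) M' → M ⊆ M')

IsAnswerSet : ∀ {n} → Program n → Subset n → Set
IsAnswerSet P M =
  IsModelP (reduct P M) M
  × ¬ (Σ (Subset _) λ M' → IsModelP (reduct P M) M' × (M' ⊂ M))

-- 2 - 1/2^t as a rational:  (2^(t+1) - 1) / 2^t
2ℚ-minus-inv-pow2 : ℕ → ℚ
2ℚ-minus-inv-pow2 t =
  _/_ (+ ((2 ^ℕ suc t) ∸ 1)) (2 ^ℕ t) {{m^n≢0 2 t}}

module Submission where

-- Minimal models are counted inside intervals P ⊆ M ⊆ U, minimal among the models
-- containing P; the atoms of U ─ P are free. If P is a model it is the only one.
-- Otherwise some clause C is false in P, and every such model satisfies a literal of C.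
-- Scanning C, a literal on a fixed atom is false in all of them, and a free atom a splits
-- them into those containing a (fix a true) and those avoiding a, which must satisfy a
-- later literal of C (fix a false). With f free atoms this gives
-- N(f) ≤ max(1, N(f-1) + ... + N(f-t)), hence N(f) ≤ q^f whenever 1 + q + ... + q^(t-1) ≤ q^t.
-- Answer sets of a program, and so its stable models, are minimal models of the theory
-- reading each rule as a clause. Finally q = 2 - 2^(-t) qualifies, since
-- q^t - (1 + ... + q^(t-1)) = 1 - (2 - q)(1 + ... + q^(t-1)) and
-- (2 - q)(1 + ... + 2^(t-1)) < (2 - q)·2^t = 1.

open import Defs

module _ where

  open import Data.Nat as ℕ using (ℕ; zero; suc; _⊔_)
  import Data.Nat.Properties as ℕ
  open import Data.Integer using (+_)
  import Data.Integer as ℤ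
  import Data.Integer.Properties as ℤ
  open import Data.Rational
    using (ℚ; 0ℚ; 1ℚ; _+_; _*_; _-_; -_; _/_; _≤_; _<_; fromℚᵘ; nonNegative)
  import Data.Rational as ℚ
  open import Data.Rational.Properties
  open import Data.Rational.Unnormalised as ℚᵘ using (mkℚᵘ; *≡*)
  import Data.Rational.Unnormalised.Properties as ℚᵘ
  open import Data.Rational.Solver using (module +-*-Solver)
  open import Data.Product using (_,_)
  open import Data.Sum using (inj₁; inj₂)
  open import Relation.Binary.PropositionalEquality using (_≡_; refl; sym; trans; cong; cong₂; subst; module ≡-Reasoning)

  open +-*-Solver

  private
    ℕ→ℚᵘ : ℕ → ℚᵘ.ℚᵘ
    ℕ→ℚᵘ k = mkℚᵘ (+ k) 0

  fromℚᵘ-homo-+ : ∀ p q → fromℚᵘ (p ℚᵘ.+ q) ≡ fromℚᵘ p + fromℚᵘ q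
  fromℚᵘ-homo-+ p q = toℚᵘ-injective (ℚᵘ.≃-trans (toℚᵘ-fromℚᵘ (p ℚᵘ.+ q)) (ℚᵘ.≃-sym
    (ℚᵘ.≃-trans (toℚᵘ-homo-+ (fromℚᵘ p) (fromℚᵘ q)) (ℚᵘ.+-cong (toℚᵘ-fromℚᵘ p) (toℚᵘ-fromℚᵘ q)))))

  fromℚᵘ-homo-* : ∀ p q → fromℚᵘ (p ℚᵘ.* q) ≡ fromℚᵘ p * fromℚᵘ q
  fromℚᵘ-homo-* p q = toℚᵘ-injective (ℚᵘ.≃-trans (toℚᵘ-fromℚᵘ (p ℚᵘ.* q)) (ℚᵘ.≃-sym
    (ℚᵘ.≃-trans (toℚᵘ-homo-* (fromℚᵘ p) (fromℚᵘ q)) (ℚᵘ.*-cong (toℚᵘ-fromℚᵘ p) (toℚᵘ-fromℚᵘ q)))))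

  ℕ→ℚ-homo-+ : ∀ a b → ℕ→ℚ (a ℕ.+ b) ≡ ℕ→ℚ a + ℕ→ℚ b
  ℕ→ℚ-homo-+ a b =
    trans (fromℚᵘ-cong {ℕ→ℚᵘ (a ℕ.+ b)} {ℕ→ℚᵘ a ℚᵘ.+ ℕ→ℚᵘ b} (*≡* eq))
          (fromℚᵘ-homo-+ (ℕ→ℚᵘ a) (ℕ→ℚᵘ b))
    where
    eq : + (a ℕ.+ b) ℤ.* + 1 ≡ (+ a ℤ.* + 1 ℤ.+ + b ℤ.* + 1) ℤ.* + 1
    eq = cong (ℤ._* + 1) (trans (ℤ.pos-+ a b) (sym (cong₂ ℤ._+_ (ℤ.*-identityʳ (+ a)) (ℤ.*-identityʳ (+ b)))))

  ℕ→ℚ-homo-* : ∀ a b → ℕ→ℚ (a ℕ.* b) ≡ ℕ→ℚ a * ℕ→ℚ b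
  ℕ→ℚ-homo-* a b =
    trans (fromℚᵘ-cong {ℕ→ℚᵘ (a ℕ.* b)} {ℕ→ℚᵘ a ℚᵘ.* ℕ→ℚᵘ b} (*≡* eq))
          (fromℚᵘ-homo-* (ℕ→ℚᵘ a) (ℕ→ℚᵘ b))
    where
    eq : + (a ℕ.* b) ℤ.* + 1 ≡ (+ a ℤ.* + b) ℤ.* + 1
    eq = cong (ℤ._* + 1) (ℤ.pos-* a b)

  ℕ→ℚ-nonNeg : ∀ k → 0ℚ ≤ ℕ→ℚ k
  ℕ→ℚ-nonNeg k = nonNegative⁻¹ (ℕ→ℚ k) {{normalize-nonNeg k 1}}

  ℕ→ℚ-mono-≤ : ∀ {a b} → a ℕ.≤ b → ℕ→ℚ a ≤ ℕ→ℚ b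
  ℕ→ℚ-mono-≤ {a} {b} a≤b = begin
    ℕ→ℚ a                  ≡⟨ +-identityʳ (ℕ→ℚ a) ⟨
    ℕ→ℚ a + 0ℚ             ≤⟨ +-monoʳ-≤ (ℕ→ℚ a) (ℕ→ℚ-nonNeg (b ℕ.∸ a)) ⟩
    ℕ→ℚ a + ℕ→ℚ (b ℕ.∸ a)  ≡⟨ ℕ→ℚ-homo-+ a (b ℕ.∸ a) ⟨
    ℕ→ℚ (a ℕ.+ (b ℕ.∸ a))  ≡⟨ cong ℕ→ℚ (ℕ.m+[n∸m]≡n a≤b) ⟩
    ℕ→ℚ b                  ∎
    where open ≤-Reasoning

  ℕ→ℚ-⊔-lub : ∀ {a b r} → ℕ→ℚ a ≤ r → ℕ→ℚ b ≤ r → ℕ→ℚ (a ⊔ b) ≤ r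
  ℕ→ℚ-⊔-lub {a} {b} {r} a≤r b≤r with ℕ.⊔-sel a b
  ... | inj₁ a⊔b≡a = subst (λ x → ℕ→ℚ x ≤ r) (sym a⊔b≡a) a≤r
  ... | inj₂ a⊔b≡b = subst (λ x → ℕ→ℚ x ≤ r) (sym a⊔b≡b) b≤r

  ℕ→ℚ-*-/-cancel : ∀ d p .{{_ : ℕ.NonZero d}} → ℕ→ℚ d * (+ p / d) ≡ ℕ→ℚ p
  ℕ→ℚ-*-/-cancel d@(suc d-1) p = trans (sym (fromℚᵘ-homo-* (ℕ→ℚᵘ d) (mkℚᵘ (+ p) d-1)))
    (fromℚᵘ-cong {ℕ→ℚᵘ d ℚᵘ.* mkℚᵘ (+ p) d-1} {ℕ→ℚᵘ p} (*≡* eq))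
    where
    eq : (+ d ℤ.* + p) ℤ.* + 1 ≡ + p ℤ.* (+ 1 ℤ.* + d)
    eq = trans (ℤ.*-identityʳ (+ d ℤ.* + p))
      (trans (ℤ.*-comm (+ d) (+ p)) (cong (+ p ℤ.*_) (sym (ℤ.*-identityˡ (+ d)))))

  0≤1 : 0ℚ ≤ 1ℚ
  0≤1 = nonNegative⁻¹ 1ℚ

  *-monoˡ-≤-nonNeg′ : ∀ {r p q} → 0ℚ ≤ r → p ≤ q → r * p ≤ r * q
  *-monoˡ-≤-nonNeg′ {r} 0≤r = *-monoˡ-≤-nonNeg r {{nonNegative 0≤r}}

  *-monoʳ-≤-nonNeg′ : ∀ {r p q} → 0ℚ ≤ r → p ≤ q → p * r ≤ q * r
  *-monoʳ-≤-nonNeg′ {r} 0≤r = *-monoʳ-≤-nonNeg r {{nonNegative 0≤r}}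

  ^ℚ-nonNeg : ∀ {q} → 0ℚ ≤ q → ∀ k → 0ℚ ≤ q ^ℚ k
  ^ℚ-nonNeg 0≤q zero        = 0≤1
  ^ℚ-nonNeg {q} 0≤q (suc k) =
    ≤-trans (≤-reflexive (sym (*-zeroʳ q))) (*-monoˡ-≤-nonNeg′ 0≤q (^ℚ-nonNeg 0≤q k))

  ^ℚ-pos : ∀ {q} → 0ℚ < q → ∀ k → 0ℚ < q ^ℚ k
  ^ℚ-pos 0<q zero        = positive⁻¹ 1ℚ
  ^ℚ-pos {q} 0<q (suc k) =
    positive⁻¹ (q ^ℚ suc k) {{pos*pos⇒pos q {{ℚ.positive 0<q}} (q ^ℚ k) {{ℚ.positive (^ℚ-pos 0<q k)}}}}

  ^ℚ-monoˡ-≤ : ∀ {p q} → 0ℚ ≤ p → p ≤ q → ∀ k → p ^ℚ k ≤ q ^ℚ k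
  ^ℚ-monoˡ-≤ 0≤p p≤q zero            = ≤-refl
  ^ℚ-monoˡ-≤ {p} {q} 0≤p p≤q (suc k) = begin
    p * p ^ℚ k  ≤⟨ *-monoˡ-≤-nonNeg′ 0≤p (^ℚ-monoˡ-≤ 0≤p p≤q k) ⟩
    p * q ^ℚ k  ≤⟨ *-monoʳ-≤-nonNeg′ (^ℚ-nonNeg (≤-trans 0≤p p≤q) k) p≤q ⟩
    q * q ^ℚ k  ∎
    where open ≤-Reasoning

  1^ℚn≡1 : ∀ k → 1ℚ ^ℚ k ≡ 1ℚ
  1^ℚn≡1 zero    = refl
  1^ℚn≡1 (suc k) = trans (*-identityˡ (1ℚ ^ℚ k)) (1^ℚn≡1 k)

  geomSum-nonNeg : ∀ {q} → 0ℚ ≤ q → ∀ k → 0ℚ ≤ geomSum q k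
  geomSum-nonNeg 0≤q zero    = ≤-refl
  geomSum-nonNeg 0≤q (suc k) = +-mono-≤ (geomSum-nonNeg 0≤q k) (^ℚ-nonNeg 0≤q k)

  1≤geomSum : ∀ {q} → 0ℚ ≤ q → ∀ k → 1ℚ ≤ geomSum q (suc k)
  1≤geomSum 0≤q zero    = ≤-refl
  1≤geomSum 0≤q (suc k) =
    ≤-trans (≤-reflexive (sym (+-identityʳ 1ℚ))) (+-mono-≤ (1≤geomSum 0≤q k) (^ℚ-nonNeg 0≤q (suc k)))

  geomSum-monoˡ-≤ : ∀ {p q} → 0ℚ ≤ p → p ≤ q → ∀ k → geomSum p k ≤ geomSum q k
  geomSum-monoˡ-≤ 0≤p p≤q zero    = ≤-refl
  geomSum-monoˡ-≤ 0≤p p≤q (suc k) = +-mono-≤ (geomSum-monoˡ-≤ 0≤p p≤q k) (^ℚ-monoˡ-≤ 0≤p p≤q k)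

  ^ℚ≡geomSum : ∀ q k → q ^ℚ k ≡ (q - 1ℚ) * geomSum q k + 1ℚ
  ^ℚ≡geomSum q zero    = solve 1 (λ q → con 1ℚ := (q :- con 1ℚ) :* con 0ℚ :+ con 1ℚ) refl q
  ^ℚ≡geomSum q (suc k) = begin
    q * q ^ℚ k
      ≡⟨ solve 2 (λ q y → q :* y := (q :- con 1ℚ) :* y :+ y) refl q (q ^ℚ k) ⟩
    (q - 1ℚ) * q ^ℚ k + q ^ℚ k
      ≡⟨ cong (_+_ ((q - 1ℚ) * q ^ℚ k)) (^ℚ≡geomSum q k) ⟩
    (q - 1ℚ) * q ^ℚ k + ((q - 1ℚ) * geomSum q k + 1ℚ)
      ≡⟨ solve 3 (λ q y g → (q :- con 1ℚ) :* y :+ ((q :- con 1ℚ) :* g :+ con 1ℚ) := (q :- con 1ℚ) :* (g :+ y) :+ con 1ℚ)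
                 refl q (q ^ℚ k) (geomSum q k) ⟩
    (q - 1ℚ) * geomSum q (suc k) + 1ℚ
      ∎
    where open ≡-Reasoning

  2ℚ : ℚ
  2ℚ = 1ℚ + 1ℚ

  geomSum≤2^ℚ : ∀ k → geomSum 2ℚ k ≤ 2ℚ ^ℚ k
  geomSum≤2^ℚ k = begin
    geomSum 2ℚ k                      ≡⟨ +-identityʳ (geomSum 2ℚ k) ⟨
    geomSum 2ℚ k + 0ℚ                 ≤⟨ +-monoʳ-≤ (geomSum 2ℚ k) 0≤1 ⟩
    geomSum 2ℚ k + 1ℚ                 ≡⟨ solve 1 (λ g → g :+ con 1ℚ := (con 2ℚ :- con 1ℚ) :* g :+ con 1ℚ)
                                                   refl (geomSum 2ℚ k) ⟩
    (2ℚ - 1ℚ) * geomSum 2ℚ k + 1ℚ     ≡⟨ ^ℚ≡geomSum 2ℚ k ⟨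
    2ℚ ^ℚ k                           ∎
    where open ≤-Reasoning

  aboveAlpha⇒1≤ : ∀ {t q} → 1 ℕ.≤ t → AboveAlpha t q → 1ℚ ≤ q
  aboveAlpha⇒1≤ {suc t} {q} _ (0<q , geomSum≤^ℚ) with ≤-total 1ℚ q
  ... | inj₁ 1≤q = 1≤q
  ... | inj₂ q≤1 = begin
    1ℚ                 ≤⟨ 1≤geomSum 0≤q t ⟩
    geomSum q (suc t)  ≤⟨ geomSum≤^ℚ ⟩
    q * q ^ℚ t         ≤⟨ *-monoˡ-≤-nonNeg′ 0≤q (^ℚ-monoˡ-≤ 0≤q q≤1 t) ⟩
    q * 1ℚ ^ℚ t        ≡⟨ cong (q *_) (1^ℚn≡1 t) ⟩
    q * 1ℚ             ≡⟨ *-identityʳ q ⟩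
    q                  ∎
    where
    open ≤-Reasoning
    0≤q : 0ℚ ≤ q
    0≤q = <⇒≤ 0<q

  aboveAlpha-criterion : ∀ {t q} → 0ℚ < q → q ≤ 2ℚ → (2ℚ - q) * 2ℚ ^ℚ t ≤ 1ℚ → AboveAlpha t q
  aboveAlpha-criterion {t} {q} 0<q q≤2 [2-q]2^t≤1 = 0<q , (begin
    geomSum q t                      ≡⟨ geomSum-telescope ⟩
    q ^ℚ t + e * geomSum q t - 1ℚ    ≤⟨ +-monoˡ-≤ (- 1ℚ) (+-monoʳ-≤ (q ^ℚ t) eG≤1) ⟩
    q ^ℚ t + 1ℚ - 1ℚ                 ≡⟨ solve 1 (λ y → y :+ con 1ℚ :- con 1ℚ := y) refl (q ^ℚ t) ⟩
    q ^ℚ t                           ∎)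
    where
    open ≤-Reasoning
    e : ℚ
    e = 2ℚ - q
    0≤e : 0ℚ ≤ e
    0≤e = ≤-trans (≤-reflexive (sym (+-inverseʳ q))) (+-monoˡ-≤ (- q) q≤2)
    eG≤1 : e * geomSum q t ≤ 1ℚ
    eG≤1 = begin
      e * geomSum q t   ≤⟨ *-monoˡ-≤-nonNeg′ 0≤e (geomSum-monoˡ-≤ (<⇒≤ 0<q) q≤2 t) ⟩
      e * geomSum 2ℚ t  ≤⟨ *-monoˡ-≤-nonNeg′ 0≤e (geomSum≤2^ℚ t) ⟩
      e * 2ℚ ^ℚ t       ≤⟨ [2-q]2^t≤1 ⟩
      1ℚ                ∎
    geomSum-telescope : geomSum q t ≡ q ^ℚ t + e * geomSum q t - 1ℚ
    geomSum-telescope = begin-equality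
      geomSum q t
        ≡⟨ solve 2 (λ q g → g := (q :- con 1ℚ) :* g :+ con 1ℚ :+ (con 2ℚ :- q) :* g :- con 1ℚ) refl q (geomSum q t) ⟩
      (q - 1ℚ) * geomSum q t + 1ℚ + e * geomSum q t - 1ℚ
        ≡⟨ cong (λ y → y + e * geomSum q t - 1ℚ) (^ℚ≡geomSum q t) ⟨
      q ^ℚ t + e * geomSum q t - 1ℚ
        ∎

  2^ℚ≡ℕ→ℚ2^ : ∀ k → 2ℚ ^ℚ k ≡ ℕ→ℚ (2 ℕ.^ k)
  2^ℚ≡ℕ→ℚ2^ zero    = refl
  2^ℚ≡ℕ→ℚ2^ (suc k) = trans (cong (2ℚ *_) (2^ℚ≡ℕ→ℚ2^ k)) (sym (ℕ→ℚ-homo-* 2 (2 ℕ.^ k)))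

  2-1/2^t-aboveAlpha : ∀ t → AboveAlpha t (2ℚ-minus-inv-pow2 t)
  2-1/2^t-aboveAlpha t = aboveAlpha-criterion {t} 0<q q≤2 (≤-reflexive [2-q]2^t≡1)
    where
    d p : ℕ
    d = 2 ℕ.^ t
    p = 2 ℕ.^ suc t ℕ.∸ 1
    q D : ℚ
    q = 2ℚ-minus-inv-pow2 t
    D = ℕ→ℚ d
    instance
      d≢0 : ℕ.NonZero d
      d≢0 = ℕ.m^n≢0 2 t
      p≢0 : ℕ.NonZero p
      p≢0 = ℕ.>-nonZero (ℕ.m<n⇒0<n∸m (ℕ.^-monoʳ-< 2 (ℕ.n<1+n 1) (ℕ.z<s {t})))
    Dq≡p : D * q ≡ ℕ→ℚ p
    Dq≡p = ℕ→ℚ-*-/-cancel d p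
    p+1≡D+D : ℕ→ℚ p + 1ℚ ≡ D + D
    p+1≡D+D = begin
      ℕ→ℚ p + ℕ→ℚ 1          ≡⟨ ℕ→ℚ-homo-+ p 1 ⟨
      ℕ→ℚ (p ℕ.+ 1)          ≡⟨ cong ℕ→ℚ (ℕ.m∸n+n≡m (ℕ.m^n>0 2 (suc t))) ⟩
      ℕ→ℚ (d ℕ.+ (d ℕ.+ 0))  ≡⟨ cong (λ x → ℕ→ℚ (d ℕ.+ x)) (ℕ.+-identityʳ d) ⟩
      ℕ→ℚ (d ℕ.+ d)          ≡⟨ ℕ→ℚ-homo-+ d d ⟩
      D + D                  ∎
      where open ≡-Reasoning
    0<q : 0ℚ < q
    0<q = positive⁻¹ q {{normalize-pos p d}}
    q≤2 : q ≤ 2ℚ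
    q≤2 = *-cancelˡ-≤-pos D {{normalize-pos d 1}} (begin
      D * q          ≡⟨ Dq≡p ⟩
      ℕ→ℚ p          ≡⟨ +-identityʳ (ℕ→ℚ p) ⟨
      ℕ→ℚ p + 0ℚ     ≤⟨ +-monoʳ-≤ (ℕ→ℚ p) 0≤1 ⟩
      ℕ→ℚ p + 1ℚ     ≡⟨ p+1≡D+D ⟩
      D + D          ≡⟨ solve 1 (λ D → D :+ D := D :* con 2ℚ) refl D ⟩
      D * 2ℚ         ∎)
      where open ≤-Reasoning
    [2-q]2^t≡1 : (2ℚ - q) * 2ℚ ^ℚ t ≡ 1ℚ
    [2-q]2^t≡1 = begin
      (2ℚ - q) * 2ℚ ^ℚ t  ≡⟨ cong ((2ℚ - q) *_) (2^ℚ≡ℕ→ℚ2^ t) ⟩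
      (2ℚ - q) * D        ≡⟨ solve 2 (λ q D → (con 2ℚ :- q) :* D := D :+ D :- D :* q) refl q D ⟩
      D + D - D * q       ≡⟨ cong₂ _-_ (sym p+1≡D+D) Dq≡p ⟩
      ℕ→ℚ p + 1ℚ - ℕ→ℚ p  ≡⟨ solve 1 (λ x → x :+ con 1ℚ :- x := con 1ℚ) refl (ℕ→ℚ p) ⟩
      1ℚ                  ∎
      where open ≡-Reasoning

-- The branching recurrence

module _ where

  open import Data.Nat as ℕ using (ℕ; zero; suc; _⊔_)
  open import Data.Rational using (0ℚ; 1ℚ; _+_; _*_; _≤_; _<_)
  import Data.Rational as ℚ
  open import Data.Rational.Properties
  open import Data.Rational.Solver using (module +-*-Solver)
  open import Relation.Binary.PropositionalEquality using (refl; sym; trans; cong)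

  open +-*-Solver

  -- modelBound t f bounds the minimal models of a t-CNF inside an interval with f free
  -- atoms; branchBound t f k bounds those that must moreover satisfy one of k literals
  -- that are false at the lower end of the interval.

  mutual
    branchBound : ℕ → ℕ → ℕ → ℕ
    branchBound t zero    k       = 0
    branchBound t (suc f) zero    = 0
    branchBound t (suc f) (suc k) = modelBound t f ℕ.+ branchBound t f k

    modelBound : ℕ → ℕ → ℕ
    modelBound t f = 1 ⊔ branchBound t f t

  module _ {t q} (1≤q : 1ℚ ≤ q) (geomSum≤^ℚ : geomSum q t ≤ q ^ℚ t) where

    private
      0<q : 0ℚ < q
      0<q = <-≤-trans (positive⁻¹ 1ℚ) 1≤q

      0≤q : 0ℚ ≤ q
      0≤q = <⇒≤ 0<q

    mutual
      branchBound≤ : ∀ f k → q ^ℚ k * ℕ→ℚ (branchBound t f k) ≤ q ^ℚ f * geomSum q k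
      branchBound≤ zero k = begin
        q ^ℚ k * 0ℚ        ≡⟨ *-zeroʳ (q ^ℚ k) ⟩
        0ℚ                 ≤⟨ geomSum-nonNeg 0≤q k ⟩
        geomSum q k        ≡⟨ *-identityˡ (geomSum q k) ⟨
        1ℚ * geomSum q k   ∎
        where open ≤-Reasoning
      branchBound≤ (suc f) zero =
        ≤-reflexive (trans (*-zeroʳ 1ℚ) (sym (*-zeroʳ (q ^ℚ suc f))))
      branchBound≤ (suc f) (suc k) = begin
        q ^ℚ suc k * ℕ→ℚ (m ℕ.+ b)
          ≡⟨ cong (q ^ℚ suc k *_) (ℕ→ℚ-homo-+ m b) ⟩
        q * q ^ℚ k * (ℕ→ℚ m + ℕ→ℚ b)
          ≡⟨ solve 4 (λ q y m b → q :* y :* (m :+ b) := q :* (y :* m) :+ q :* (y :* b)) refl q (q ^ℚ k) (ℕ→ℚ m) (ℕ→ℚ b) ⟩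
        q * (q ^ℚ k * ℕ→ℚ m) + q * (q ^ℚ k * ℕ→ℚ b)
          ≤⟨ +-mono-≤ (*-monoˡ-≤-nonNeg′ 0≤q (*-monoˡ-≤-nonNeg′ (^ℚ-nonNeg 0≤q k) (modelBound≤ f)))
                      (*-monoˡ-≤-nonNeg′ 0≤q (branchBound≤ f k)) ⟩
        q * (q ^ℚ k * q ^ℚ f) + q * (q ^ℚ f * geomSum q k)
          ≡⟨ solve 4 (λ q y z g → q :* (y :* z) :+ q :* (z :* g) := q :* z :* (g :+ y)) refl q (q ^ℚ k) (q ^ℚ f) (geomSum q k) ⟩
        q ^ℚ suc f * geomSum q (suc k)
          ∎
        where
        open ≤-Reasoning
        m b : ℕ
        m = modelBound t f
        b = branchBound t f k

      modelBound≤ : ∀ f → ℕ→ℚ (modelBound t f) ≤ q ^ℚ f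
      modelBound≤ f = ℕ→ℚ-⊔-lub {1} {branchBound t f t}
        (≤-trans (≤-reflexive (sym (1^ℚn≡1 f))) (^ℚ-monoˡ-≤ 0≤1 1≤q f))
        (*-cancelˡ-≤-pos (q ^ℚ t) {{ℚ.positive (^ℚ-pos 0<q t)}} (begin
          q ^ℚ t * ℕ→ℚ (branchBound t f t)  ≤⟨ branchBound≤ f t ⟩
          q ^ℚ f * geomSum q t              ≤⟨ *-monoˡ-≤-nonNeg′ (^ℚ-nonNeg 0≤q f) geomSum≤^ℚ ⟩
          q ^ℚ f * q ^ℚ t                   ≡⟨ *-comm (q ^ℚ f) (q ^ℚ t) ⟩
          q ^ℚ t * q ^ℚ f                   ∎))
        where open ≤-Reasoning

module _ {A : Set} where

  open import Data.Nat using (ℕ; suc; _≤_; _+_; z≤n; s≤s)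
  import Data.Nat.Properties as ℕ
  open import Data.List using ([]; _∷_; length; filter)
  open import Data.List.Relation.Unary.All as All using (All; _∷_)
  open import Data.List.Relation.Unary.All.Properties using (all-filter; filter⁺)
  open import Data.List.Relation.Unary.AllPairs using (_∷_)
  open import Data.List.Relation.Unary.Unique.Propositional using (Unique)
  import Data.List.Relation.Unary.Unique.Propositional.Properties as Unique
  open import Data.Product using (_,_)
  open import Data.Empty using (⊥-elim)
  open import Relation.Nullary using (¬_; yes; no)
  open import Relation.Unary using (Decidable; _∩_; ∁; _⊆_)
  open import Relation.Unary.Properties using (∁?)
  open import Relation.Binary.PropositionalEquality using (_≡_; refl; sym; trans; cong)

  AtMost : ℕ → (A → Set) → Set
  AtMost N P = ∀ xs → Unique xs → All P xs → length xs ≤ N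

  atMost-weaken : ∀ {N N′} {P : A → Set} → N ≤ N′ → AtMost N P → AtMost N′ P
  atMost-weaken N≤N′ atMost xs unique ps = ℕ.≤-trans (atMost xs unique ps) N≤N′

  atMost-restrict : ∀ {N} {P Q : A → Set} → P ⊆ Q → AtMost N Q → AtMost N P
  atMost-restrict P⊆Q atMost xs unique ps = atMost xs unique (All.map P⊆Q ps)

  atMost-none : ∀ {N} {P : A → Set} → (∀ {x} → ¬ P x) → AtMost N P
  atMost-none ¬P []      _ _        = z≤n
  atMost-none ¬P (_ ∷ _) _ (px ∷ _) = ⊥-elim (¬P px)

  atMost-one : ∀ {P : A → Set} {z} → (∀ {x} → P x → x ≡ z) → AtMost 1 P
  atMost-one P⇒≡z []          _               _             = z≤n
  atMost-one P⇒≡z (_ ∷ [])    _               _             = s≤s z≤n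
  atMost-one P⇒≡z (_ ∷ _ ∷ _) ((x≢y ∷ _) ∷ _) (px ∷ py ∷ _) =
    ⊥-elim (x≢y (trans (P⇒≡z px) (sym (P⇒≡z py))))

  length-filter+filter-∁ : ∀ {Q : A → Set} (Q? : Decidable Q) xs →
    length (filter Q? xs) + length (filter (∁? Q?) xs) ≡ length xs
  length-filter+filter-∁ Q? []       = refl
  length-filter+filter-∁ Q? (x ∷ xs) with Q? x
  ... | yes _ = cong suc (length-filter+filter-∁ Q? xs)
  ... | no  _ = trans (ℕ.+-suc _ _) (cong suc (length-filter+filter-∁ Q? xs))

  atMost-split : ∀ {N₁ N₂} {P Q : A → Set} → Decidable Q →
    AtMost N₁ (P ∩ Q) → AtMost N₂ (P ∩ ∁ Q) → AtMost (N₁ + N₂) P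
  atMost-split {N₁} {N₂} {P} Q? atMost₁ atMost₂ xs unique ps = begin
    length xs                                           ≡⟨ length-filter+filter-∁ Q? xs ⟨
    length (filter Q? xs) + length (filter (∁? Q?) xs)
      ≤⟨ ℕ.+-mono-≤ (atMost₁ _ (unique-filter Q?) (all-filter-∩ Q?))
                    (atMost₂ _ (unique-filter (∁? Q?)) (all-filter-∩ (∁? Q?))) ⟩
    N₁ + N₂                                             ∎
    where
    open ℕ.≤-Reasoning
    unique-filter : ∀ {R} (R? : Decidable R) → Unique (filter R? xs)
    unique-filter R? = Unique.filter⁺ R? unique
    all-filter-∩ : ∀ {R} (R? : Decidable R) → All (P ∩ R) (filter R? xs)
    all-filter-∩ R? = All.zip (filter⁺ R? ps , all-filter R? xs)

-- Minimal models inside an interval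

module _ where

  open import Data.Nat as ℕ using (zero; suc; _≤_; _<_; s≤s)
  import Data.Nat.Properties as ℕ
  open import Data.Bool using (true; false)
  open import Data.Fin using (Fin)
  open import Data.Fin.Subset using (Subset; _∈_; _∉_; _⊆_; _⊂_; _∪_; _─_; _-_; ⁅_⁆; ⊥; ⊤; ∣_∣)
  open import Data.Fin.Subset.Properties
    using (_∈?_; ⊆-refl; ⊆-antisym; ⊆-min; ⊆⊤; x∈p∪q⁺; x∈p∪q⁻; x∈⁅y⁆⇒x≡y; x∈p∧x∉q⇒x∈p─q;
           x∈p∧x≢y⇒x∈p-y; x∈p⇒∣p-x∣<∣p∣; p─q─r≡p─q∪r; p─q─r≡p─r─q; p─⊥≡p; ∣⊤∣≡n)
  open import Data.List using ([]; _∷_; length)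
  open import Data.List.Relation.Unary.All as All using (All; _∷_; all?)
  open import Data.List.Relation.Unary.All.Properties using (¬All⇒Any¬; ¬Any⇒All¬)
  open import Data.List.Relation.Unary.Any as Any using (Any; any?)
  open import Data.List.Membership.Propositional using (find)
  open import Data.Product using (_×_; _,_)
  open import Data.Sum using (inj₁; inj₂)
  open import Data.Empty using (⊥-elim)
  open import Function using (_∘_)
  open import Relation.Nullary using (¬_; Dec; yes; no; ¬?; contradiction)
  open import Relation.Binary.PropositionalEquality using (_≡_; refl; sym; trans; cong; subst)

  x∈p─q⇒∣p─[q∪⁅x⁆]∣<∣p─q∣ : ∀ {n} {p q : Subset n} {x} → x ∈ p ─ q → ∣ p ─ (q ∪ ⁅ x ⁆) ∣ < ∣ p ─ q ∣
  x∈p─q⇒∣p─[q∪⁅x⁆]∣<∣p─q∣ {p = p} {q} {x} x∈p─q =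
    subst (λ r → ∣ r ∣ < ∣ p ─ q ∣) (p─q─r≡p─q∪r p q ⁅ x ⁆) (x∈p⇒∣p-x∣<∣p∣ x∈p─q)

  x∈p─q⇒∣[p-x]─q∣<∣p─q∣ : ∀ {n} {p q : Subset n} {x} → x ∈ p ─ q → ∣ (p - x) ─ q ∣ < ∣ p ─ q ∣
  x∈p─q⇒∣[p-x]─q∣<∣p─q∣ {p = p} {q} {x} x∈p─q =
    subst (λ r → ∣ r ∣ < ∣ p ─ q ∣) (p─q─r≡p─r─q p q ⁅ x ⁆) (x∈p⇒∣p-x∣<∣p∣ x∈p─q)

  satLit? : ∀ {n} (M : Subset n) (l : Literal n) → Dec (SatLit M l)
  satLit? M (lit a true)  = a ∈? M
  satLit? M (lit a false) = ¬? (a ∈? M)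

  module _ {n} (T : CNF n) where

    isModel? : (M : Subset n) → Dec (IsModelCNF T M)
    isModel? M = all? (any? (satLit? M)) T

    record IsMinimalModelWithin (P U M : Subset n) : Set where
      field
        model   : IsModelCNF T M
        lower   : P ⊆ M
        upper   : M ⊆ U
        minimal : ∀ {M′} → IsModelCNF T M′ → P ⊆ M′ → ¬ (M′ ⊂ M)

    open IsMinimalModelWithin

    minimalModel⇒within : ∀ {M} → IsMinimalModelCNF T M → IsMinimalModelWithin ⊥ ⊤ M
    minimalModel⇒within {M} (M-model , M-minimal) = record
      { model   = M-model
      ; lower   = ⊆-min M
      ; upper   = ⊆⊤
      ; minimal = λ M′-model _ M′⊂M → M-minimal (_ , M′-model , M′⊂M)
      }

    within-fix-true : ∀ {P U M a} → a ∈ M → IsMinimalModelWithin P U M → IsMinimalModelWithin (P ∪ ⁅ a ⁆) U M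
    within-fix-true {P} {U} {M} {a} a∈M w = record
      { model   = model w
      ; lower   = P∪a⊆M
      ; upper   = upper w
      ; minimal = λ M′-model P∪a⊆M′ → minimal w M′-model (P∪a⊆M′ ∘ x∈p∪q⁺ ∘ inj₁)
      }
      where
      P∪a⊆M : P ∪ ⁅ a ⁆ ⊆ M
      P∪a⊆M {x} x∈P∪a with x∈p∪q⁻ P ⁅ a ⁆ x∈P∪a
      ... | inj₁ x∈P = lower w x∈P
      ... | inj₂ x∈a = subst (_∈ M) (sym (x∈⁅y⁆⇒x≡y a x∈a)) a∈M

    within-fix-false : ∀ {P U M a} → a ∉ M → IsMinimalModelWithin P U M → IsMinimalModelWithin P (U - a) M
    within-fix-false {a = a} a∉M w = record
      { model   = model w
      ; lower   = lower w
      ; upper   = λ x∈M → x∈p∧x≢y⇒x∈p-y (upper w x∈M) (λ { refl → a∉M x∈M })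
      ; minimal = minimal w
      }

    within-unique : ∀ {P U M} → IsModelCNF T P → IsMinimalModelWithin P U M → M ≡ P
    within-unique {P} {U} {M} P-model w = ⊆-antisym M⊆P (lower w)
      where
      M⊆P : M ⊆ P
      M⊆P {x} x∈M with x ∈? P
      ... | yes x∈P = x∈P
      ... | no  x∉P = ⊥-elim (minimal w P-model ⊆-refl (lower w , x , x∈M , x∉P))

  satLit-fixed : ∀ {n} {P U M : Subset n} {l} → P ⊆ M → M ⊆ U → atom l ∉ U ─ P → SatLit M l → SatLit P l
  satLit-fixed {P = P} {l = lit a true} P⊆M M⊆U a-fixed a∈M with a ∈? P
  ... | yes a∈P = a∈P
  ... | no  a∉P = ⊥-elim (a-fixed (x∈p∧x∉q⇒x∈p─q (M⊆U a∈M) a∉P))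
  satLit-fixed {l = lit a false} P⊆M M⊆U a-fixed a∉M = a∉M ∘ P⊆M

  ¬satLit-extend : ∀ {n} {P M : Subset n} {l} → P ⊆ M → atom l ∉ M → ¬ SatLit P l → ¬ SatLit M l
  ¬satLit-extend {l = lit a true}  P⊆M a∉M ¬Pl a∈M = a∉M a∈M
  ¬satLit-extend {l = lit a false} P⊆M a∉M ¬Pl _   = ¬Pl (a∉M ∘ P⊆M)

  module _ {n} {T : CNF n} {t} (T-clauses≤t : All (λ C → length C ≤ t) T) where

    open IsMinimalModelWithin

    mutual
      within-count : ∀ f P U → ∣ U ─ P ∣ ≤ f → AtMost (modelBound t f) (IsMinimalModelWithin T P U)
      within-count f P U free≤f with isModel? T P
      ... | yes P-model = atMost-weaken (ℕ.m≤m⊔n 1 (branchBound t f t)) (atMost-one (within-unique T P-model))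
      ... | no ¬P-model with find (¬All⇒Any¬ (any? (satLit? P)) T ¬P-model)
      ...   | C , C∈T , ¬P⊨C = atMost-weaken (ℕ.m≤n⊔m 1 (branchBound t f t))
                (atMost-restrict (λ w → w , All.lookup (model w) C∈T)
                  (falsified-count f t P U free≤f C (All.lookup T-clauses≤t C∈T) (¬Any⇒All¬ C ¬P⊨C)))

      falsified-count : ∀ f k P U → ∣ U ─ P ∣ ≤ f → ∀ D → length D ≤ k → All (¬_ ∘ SatLit P) D →
        AtMost (branchBound t f k) (λ M → IsMinimalModelWithin T P U M × Any (SatLit M) D)
      falsified-count f k P U free≤f []      _        _          = atMost-none (λ { (_ , ()) })
      falsified-count f k P U free≤f (l ∷ D) |l∷D|≤k (¬Pl ∷ ¬PD) with atom l ∈? U ─ P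
      ... | yes l-free  = branch-count f k P U free≤f l D |l∷D|≤k l-free ¬Pl ¬PD
      ... | no  l-fixed = atMost-restrict skip
              (falsified-count f k P U free≤f D (ℕ.≤-trans (ℕ.n≤1+n _) |l∷D|≤k) ¬PD)
        where
        skip : ∀ {M} → IsMinimalModelWithin T P U M × Any (SatLit M) (l ∷ D) →
                       IsMinimalModelWithin T P U M × Any (SatLit M) D
        skip (w , M⊨l∷D) = w , Any.tail (¬Pl ∘ satLit-fixed (lower w) (upper w) l-fixed) M⊨l∷D

      branch-count : ∀ f k P U → ∣ U ─ P ∣ ≤ f → ∀ l D → length (l ∷ D) ≤ k → atom l ∈ U ─ P →
        ¬ SatLit P l → All (¬_ ∘ SatLit P) D →
        AtMost (branchBound t f k) (λ M → IsMinimalModelWithin T P U M × Any (SatLit M) (l ∷ D))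
      branch-count zero    k       P U free≤0 l D _ l-free _ _ =
        contradiction (ℕ.≤-trans (x∈p⇒∣p-x∣<∣p∣ l-free) free≤0) λ ()
      branch-count (suc f) (suc k) P U free≤f l D (s≤s |D|≤k) l-free ¬Pl ¬PD =
        atMost-split (a ∈?_)
          (atMost-restrict (λ ((w , _) , a∈M) → within-fix-true T a∈M w)
            (within-count f (P ∪ ⁅ a ⁆) U free[a:=true]≤f))
          (atMost-restrict
            (λ ((w , M⊨l∷D) , a∉M) →
              within-fix-false T a∉M w , Any.tail (¬satLit-extend (lower w) a∉M ¬Pl) M⊨l∷D)
            (falsified-count f k P (U - a) free[a:=false]≤f D |D|≤k ¬PD))
        where
        a : Fin n
        a = atom l
        free[a:=true]≤f : ∣ U ─ (P ∪ ⁅ a ⁆) ∣ ≤ f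
        free[a:=true]≤f = ℕ.≤-pred (ℕ.≤-trans (x∈p─q⇒∣p─[q∪⁅x⁆]∣<∣p─q∣ l-free) free≤f)
        free[a:=false]≤f : ∣ (U - a) ─ P ∣ ≤ f
        free[a:=false]≤f = ℕ.≤-pred (ℕ.≤-trans (x∈p─q⇒∣[p-x]─q∣<∣p─q∣ l-free) free≤f)

    minimalModel-count : AtMost (modelBound t n) (IsMinimalModelCNF T)
    minimalModel-count = atMost-restrict (minimalModel⇒within T)
      (within-count n ⊥ ⊤ (ℕ.≤-reflexive (trans (cong ∣_∣ (p─⊥≡p (⊤ {n}))) (∣⊤∣≡n n))))

-- From programs to CNF

module _ where

  open import Data.Nat using (ℕ; _≤_; _+_)
  open import Data.Nat.Properties using (+-assoc)
  open import Data.Bool using (true; false)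
  open import Data.Fin using (Fin)
  open import Data.Fin.Subset using (Subset; _∈_; _⊆_)
  open import Data.Fin.Subset.Properties using (_∈?_)
  open import Data.List using ([]; length; map; filter; _++_)
  open import Data.List.Properties using (length-++; length-map)
  open import Data.List.Relation.Unary.All as All using (All; all?)
  open import Data.List.Relation.Unary.All.Properties as All
    using (all-filter; filter⁺; filter⁻; ¬All⇒Any¬; Any¬⇒¬All)
  open import Data.List.Relation.Unary.Any as Any using (Any; any?)
  import Data.List.Relation.Unary.Any.Properties as Any
  open import Data.Product using (_×_; _,_; proj₁)
  open import Data.Sum using (inj₁; inj₂)
  open import Data.Empty using (⊥-elim)
  open import Function using (_∘_; const)
  open import Relation.Nullary using (¬_; yes; no; ¬?)
  open import Relation.Unary using (Decidable)
  open import Relation.Unary.Properties using (∁?)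
  open import Relation.Binary.PropositionalEquality using (_≡_; sym; cong; cong₂; subst; module ≡-Reasoning)

  module _ {A : Set} {P Q : A → Set} (P? : Decidable P) where

    All-filter⇒ : ∀ xs → All Q (filter P? xs) → All (λ x → P x → Q x) xs
    All-filter⇒ xs Q[filter] =
      filter⁻ P? (All.map const Q[filter]) (All.map (λ ¬px px → ⊥-elim (¬px px)) (all-filter (∁? P?) xs))

    ⇒All-filter : ∀ xs → All (λ x → P x → Q x) xs → All Q (filter P? xs)
    ⇒All-filter xs P⇒Q = All.zipWith (λ (f , px) → f px) (filter⁺ P? P⇒Q , all-filter P? xs)

  module _ {n : ℕ} where

    positiveLit negativeLit : Fin n → Literal n
    positiveLit a = lit a true
    negativeLit a = lit a false

    toClause : DClause n → Clause n
    toClause C = map positiveLit (heads C) ++ map negativeLit (pos C) ++ map positiveLit (neg C)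

    toCNF : Program n → CNF n
    toCNF = map toClause

    length-toClause : ∀ C → length (toClause C) ≡ size C
    length-toClause C = begin
      length (H ++ B ++ N)                  ≡⟨ length-++ H ⟩
      length H + length (B ++ N)            ≡⟨ cong (length H +_) (length-++ B) ⟩
      length H + (length B + length N)      ≡⟨ +-assoc (length H) (length B) (length N) ⟨
      length H + length B + length N
        ≡⟨ cong₂ _+_ (cong₂ _+_ (length-map positiveLit (heads C)) (length-map negativeLit (pos C)))
                     (length-map positiveLit (neg C)) ⟩
      size C                                ∎
      where
      open ≡-Reasoning
      H B N : Clause n
      H = map positiveLit (heads C)
      B = map negativeLit (pos C)
      N = map positiveLit (neg C)

    toCNF-clauses≤ : ∀ {t} {Φ : DClause n → Set} (P : Program n) → All (λ C → Φ C × (size C ≤ t)) P →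
      All (λ C → length C ≤ t) (toCNF P)
    toCNF-clauses≤ {t} P clauses≤t =
      All.map⁺ (All.map (λ {C} (_ , size≤t) → subst (_≤ t) (sym (length-toClause C)) size≤t) clauses≤t)

    dropNeg : DClause n → DClause n
    dropNeg C = heads C ⇐ pos C ,not []

    module _ {Q : DClause n → Set} (P : Program n) (M : Subset n) where

      All-reduct⇒ : All Q (reduct P M) → All (λ C → ¬ Any (_∈ M) (neg C) → Q (dropNeg C)) P
      All-reduct⇒ = All-filter⇒ (λ C → ¬? (any? (_∈? M) (neg C))) P ∘ All.map⁻

      ⇒All-reduct : All (λ C → ¬ Any (_∈ M) (neg C) → Q (dropNeg C)) P → All Q (reduct P M)
      ⇒All-reduct = All.map⁺ ∘ ⇒All-filter (λ C → ¬? (any? (_∈? M) (neg C))) P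

    satisfies-toClause : ∀ {M} C → (¬ Any (_∈ M) (neg C) → SatClause M (dropNeg C)) → Any (SatLit M) (toClause C)
    satisfies-toClause {M} C M⊨C with any? (_∈? M) (neg C) | all? (_∈? M) (pos C)
    ... | yes neg∩M | _ =
      Any.++⁺ʳ (map positiveLit (heads C)) (Any.++⁺ʳ (map negativeLit (pos C)) (Any.map⁺ neg∩M))
    ... | no ¬neg∩M | yes pos⊆M =
      Any.++⁺ˡ (Any.map⁺ (M⊨C ¬neg∩M pos⊆M All.[]))
    ... | no _      | no pos⊈M =
      Any.++⁺ʳ (map positiveLit (heads C)) (Any.++⁺ˡ (Any.map⁺ (¬All⇒Any¬ (_∈? M) (pos C) pos⊈M)))

    toClause-satisfies : ∀ {M M′} C → M′ ⊆ M → Any (SatLit M′) (toClause C) →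
      ¬ Any (_∈ M) (neg C) → SatClause M′ (dropNeg C)
    toClause-satisfies {M} {M′} C M′⊆M M′⊨C ¬neg∩M pos⊆M′ _ with Any.++⁻ (map positiveLit (heads C)) M′⊨C
    ... | inj₁ heads∩M′ = Any.map⁻ heads∩M′
    ... | inj₂ M′⊨rest with Any.++⁻ (map negativeLit (pos C)) M′⊨rest
    ...   | inj₁ pos⊈M′ = ⊥-elim (Any¬⇒¬All (Any.map⁻ pos⊈M′) pos⊆M′)
    ...   | inj₂ neg∩M′ = ⊥-elim (¬neg∩M (Any.map M′⊆M (Any.map⁻ neg∩M′)))

    answerSet⇒minimalModel : ∀ P {M} → IsAnswerSet P M → IsMinimalModelCNF (toCNF P) M
    answerSet⇒minimalModel P {M} (M⊨P^M , M-minimal) =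
      M-model , λ (M′ , M′-model , M′⊂M) → M-minimal (M′ , reduct-model M′-model (proj₁ M′⊂M) , M′⊂M)
      where
      M-model : IsModelCNF (toCNF P) M
      M-model = All.map⁺ (All.map (λ {C} → satisfies-toClause C) (All-reduct⇒ P M M⊨P^M))
      reduct-model : ∀ {M′} → IsModelCNF (toCNF P) M′ → M′ ⊆ M → IsModelP (reduct P M) M′
      reduct-model M′-model M′⊆M =
        ⇒All-reduct P M (All.map (λ {C} → toClause-satisfies C M′⊆M) (All.map⁻ M′-model))

    stable⇒answerSet : ∀ (P : Program n) {M} → IsStableModel P M → IsAnswerSet P M
    stable⇒answerSet P (M⊨P^M , M-least) =
      M⊨P^M , λ (M′ , M′⊨P^M , (_ , x , x∈M , x∉M′)) → x∉M′ (M-least M′ M′⊨P^M x∈M)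

open import Data.Nat using (ℕ; _≤_)
open import Data.Nat.Properties using (≤-trans; n≤1+n)
open import Data.Fin.Subset using (Subset)
open import Data.List using (List; length)
open import Data.List.Relation.Unary.All as All using (All)
open import Data.List.Relation.Unary.Unique.Propositional using (Unique)
open import Data.Product using (_×_; _,_; proj₁)
open import Function using (_∘_)
import Data.Rational.Properties as ℚ

minimalModels≤α : ∀ {n t} {T : CNF n} → 1 ≤ t → All (λ C → length C ≤ t) T →
  (Ms : List (Subset n)) → Unique Ms → All (IsMinimalModelCNF T) Ms → length Ms ≤α[ t ]^ n
minimalModels≤α {n} {t} 1≤t T-clauses≤t Ms unique minimal q above@(_ , geomSum≤^ℚ) = begin
  ℕ→ℚ (length Ms)       ≤⟨ ℕ→ℚ-mono-≤ (minimalModel-count T-clauses≤t Ms unique minimal) ⟩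
  ℕ→ℚ (modelBound t n)  ≤⟨ modelBound≤ (aboveAlpha⇒1≤ 1≤t above) geomSum≤^ℚ n ⟩
  q ^ℚ n                ∎
  where open ℚ.≤-Reasoning

theorem8p2 : (t : ℕ) → 2 ≤ t → (n : ℕ)
    → ((T : CNF n) → IsTCNF t T → (Ms : List (Subset n)) → Unique Ms
         → All (IsMinimalModelCNF T) Ms → length Ms ≤α[ t ]^ n)
    × ((P : Program n) → IsNormalTProgram t P → (Ms : List (Subset n)) → Unique Ms
         → All (IsStableModel P) Ms → length Ms ≤α[ t ]^ n)
    × ((P : Program n) → IsDisjTProgram t P → (Ms : List (Subset n)) → Unique Ms
         → All (IsAnswerSet P) Ms → length Ms ≤α[ t ]^ n)
    × AboveAlpha t (2ℚ-minus-inv-pow2 t)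
theorem8p2 t 2≤t n =
    (λ T T-t → minimalModels≤α 1≤t (All.map proj₁ T-t))
  , (λ P P-t Ms unique stable → minimalModels≤α 1≤t (toCNF-clauses≤ P P-t) Ms unique
       (All.map (answerSet⇒minimalModel P ∘ stable⇒answerSet P) stable))
  , (λ P P-t Ms unique answerSets → minimalModels≤α 1≤t (toCNF-clauses≤ P P-t) Ms unique
       (All.map (answerSet⇒minimalModel P) answerSets))
  , 2-1/2^t-aboveAlpha t
  where
  1≤t : 1 ≤ t
  1≤t = ≤-trans (n≤1+n 1) 2≤t
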